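{- Let $P$ be a finite Eulerian Sheffer poset of rank $n$ with factorial functions $B(k) = k!$ for $k \leq n-1$ and $D(k) = 2\cdot(k-1)!$ for $2 \leq k \leq n$. Then $P$ is isomorphic to $\Sigma^*(B_{n-1})$.
   Context: A finite Sheffer poset is a poset with a unique minimal element $\hat 0$ and a unique maximal element, in which every interval is graded (rank function $\rho$, $\rho(\hat0)=0$; $[x,y]$ is a $k$-interval if $\rho(y)-\rho(x)=k$), any two $k$-intervals $[\hat0,y]$, $[\hat0,v]$ with $y,v\neq\hat0$ have the same number $D(k)$ of maximal chains, and any two $k$-intervals $[x,y]$, $[u,v]$ with $x,u\neq\hat0$ have the same number $B(k)$ of maximal chains. A poset is Eulerian if $\mu(x,y)=(-1)^{\rho(y)-\rho(x)}$ for all $x\le y$. $B_{n-1}$ is the Boolean algebra of subsets of an $(n-1)$-set. For a poset $R$ with minimum $\hat0$, the dual suspension $\Sigma^*(R)$ is $R$ with two new elements $a_1,a_2$ added, with $\hat0<a_i<y$ for all $y>\hat0$ in $R$, $i=1,2$. -}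

module Defs where

open import Data.Nat using (ℕ; zero; suc; _∸_)
open import Data.Bool using (Bool; true; false; _∧_; not; if_then_else_; T)
open import Data.Fin using (Fin; _≟_)
open import Data.List using (List; []; _∷_; allFin; map; foldr)
open import Data.Bool.ListAction using (any)
open import Data.Integer using (ℤ; _+_; -_; 0ℤ; 1ℤ)
open import Data.Product using (Σ; _×_)
open import Data.Sum using (_⊎_; inj₁; inj₂)
open import Data.Fin.Subset as Sub using (Subset; _⊆_; Nonempty)
open import Relation.Nullary using (¬_)
open import Relation.Nullary.Decidable using (⌊_⌋)
open import Relation.Binary.PropositionalEquality using (_≡_)
open import Function.Bundles using (_↔_; _⇔_; Inverse)

record FinPoset (m : ℕ) : Set where
  field
    _≤ᵇ_    : Fin m → Fin m → Bool
    ≤-refl  : ∀ x → T (x ≤ᵇ x)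
    ≤-antisym : ∀ x y → T (x ≤ᵇ y) → T (y ≤ᵇ x) → x ≡ y
    ≤-trans : ∀ x y z → T (x ≤ᵇ y) → T (y ≤ᵇ z) → T (x ≤ᵇ z)

module _ {m : ℕ} (P : FinPoset m) where
  open FinPoset P

  _<ᵇ_ : Fin m → Fin m → Bool
  x <ᵇ y = (x ≤ᵇ y) ∧ not ⌊ x ≟ y ⌋

  _⋖ᵇ_ : Fin m → Fin m → Bool
  x ⋖ᵇ z = (x <ᵇ z) ∧ not (any (λ w → (x <ᵇ w) ∧ (w <ᵇ z)) (allFin m))

  -- l = [x₁, …, x_k] such that x ⋖ x₁ ⋖ … ⋖ x_k = y (or l = [] and x = y):
  -- a maximal chain of the interval [x,y] (listing the elements above x).
  isMaxChain : Fin m → Fin m → List (Fin m) → Bool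
  isMaxChain x y []      = ⌊ x ≟ y ⌋
  isMaxChain x y (z ∷ l) = (x ⋖ᵇ z) ∧ isMaxChain z y l

  NumMaxChains : Fin m → Fin m → ℕ → Set
  NumMaxChains x y N = Σ (List (Fin m)) (λ l → T (isMaxChain x y l)) ↔ Fin N

  IsBottom : Fin m → Set
  IsBottom b = ∀ x → T (b ≤ᵇ x)

  IsTop : Fin m → Set
  IsTop t = ∀ x → T (x ≤ᵇ t)

  IsRankFunction : Fin m → (Fin m → ℕ) → Set
  IsRankFunction bot ρ = (ρ bot ≡ 0) × (∀ x y → T (x ⋖ᵇ y) → ρ y ≡ suc (ρ x))

  sumℤ : List ℤ → ℤ
  sumℤ = foldr _+_ 0ℤ

  mobiusFuel : ℕ → Fin m → Fin m → ℤ
  mobiusFuel zero    x y = 0ℤ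
  mobiusFuel (suc f) x y =
    if ⌊ x ≟ y ⌋ then 1ℤ
    else if x ≤ᵇ y
      then - sumℤ (map (λ z → if (x ≤ᵇ z) ∧ (z <ᵇ y) then mobiusFuel f x z else 0ℤ) (allFin m))
      else 0ℤ

  -- fuel m suffices: chains in a poset on m elements have fewer than m steps
  mobius : Fin m → Fin m → ℤ
  mobius = mobiusFuel m

  negOnePow : ℕ → ℤ
  negOnePow zero    = 1ℤ
  negOnePow (suc k) = - negOnePow k

  IsEulerian : (Fin m → ℕ) → Set
  IsEulerian ρ = ∀ x y → T (x ≤ᵇ y) → mobius x y ≡ negOnePow (ρ y ∸ ρ x)

  IsSheffer : Fin m → (Fin m → ℕ) → (ℕ → ℕ) → (ℕ → ℕ) → Set
  IsSheffer bot ρ B D =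
    (∀ y → ¬ (y ≡ bot) → NumMaxChains bot y (D (ρ y))) ×
    (∀ x y → ¬ (x ≡ bot) → T (x ≤ᵇ y) → NumMaxChains x y (B (ρ y ∸ ρ x)))

-- Dual suspension Σ*(B_k) of the Boolean algebra B_k of subsets of a k-set:
-- inj₁ S is a subset S, inj₂ false / inj₂ true are the new elements a₁, a₂.
DualSuspBool : ℕ → Set
DualSuspBool k = Subset k ⊎ Bool

_≤Σ_ : ∀ {k} → DualSuspBool k → DualSuspBool k → Set
inj₁ S ≤Σ inj₁ U = S ⊆ U
inj₁ S ≤Σ inj₂ _ = S ≡ Sub.⊥
inj₂ i ≤Σ inj₂ j = i ≡ j
inj₂ _ ≤Σ inj₁ S = Nonempty S

IsoToDualSuspBool : ∀ {m} → FinPoset m → ℕ → Set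
IsoToDualSuspBool {m} P k =
  Σ (Fin m ↔ DualSuspBool k) λ f →
    ∀ x y → T (FinPoset._≤ᵇ_ P x y) ⇔ (Inverse.to f x ≤Σ Inverse.to f y)

{-# OPTIONS --safe #-}
-- Counting maximal chains by their first atom turns B(k) = k! and D(k) = 2·(k−1)! into atom
-- counts: an interval [x, y] with x ≠ 0̂ has exactly ρ(y) − ρ(x) atoms, and every [0̂, y] with
-- ρ(y) ≥ 2 has exactly two. So P has two atoms a₁, a₂, and every other nonzero element lies above
-- both. For x ≠ 0̂, an induction downwards from the top shows that two atoms of [x, ⊤] have exactly
-- one common cover, and that it lies below each of their common upper bounds. Hence an element of
-- [x, ⊤] is determined by the atoms below it and every set of atoms occurs, i.e. [x, ⊤] is Boolean.
-- For x = a₁ this exhibits P = {0̂, a₁, a₂} ∪ (a₁, ⊤] as the dual suspension of [a₁, ⊤] ≅ B_{n−1}.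
module Submission where

open import Defs
open import Data.Nat using (ℕ; _≤_; _∸_; _*_)
open import Data.Nat using (_!)
open import Data.Fin using (Fin)
open import Relation.Binary.PropositionalEquality using (_≡_)

open import Data.Bool using (Bool; true; false; _∧_; not; T; if_then_else_)
open import Data.Bool.ListAction using (any)
open import Data.Bool.Properties using (T-∧; T-≡; T-irrelevant)
open import Data.Empty using (⊥; ⊥-elim)
open import Data.Fin using (zero; suc; _≟_)
open import Data.Fin.Induction using (po-wellFounded; po-noetherian)
open import Data.Fin.Properties using (any?; injective⇒≤; cantor-schröder-bernstein; *↔×)
open import Data.Fin.Subset as Subset using (Subset; _∈_; _⊆_; Nonempty)
open import Data.Fin.Subset.Properties using (nonempty?; Empty-unique; ∉⊥; ⊥⊆; ⊆-antisym)
open import Data.List using (List; []; _∷_; allFin)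
open import Data.List.Membership.Propositional using (lose)
open import Data.List.Membership.Propositional.Properties using (∈-allFin)
open import Data.List.Relation.Unary.Any using (satisfied)
open import Data.List.Relation.Unary.Any.Properties using (any⁺; any⁻)
open import Data.Nat using (zero; suc; _+_; _<_; z≤n; s≤s)
import Data.Nat.Properties as ℕ
open import Data.Product using (Σ; ∃; _×_; _,_; proj₁; proj₂)
open import Data.Product.Function.Dependent.Propositional using (congˡ)
open import Data.Product.Function.NonDependent.Propositional using (_×-↔_)
open import Data.Sum using (_⊎_; inj₁; inj₂; [_,_]′)
open import Data.Sum.Function.Propositional using (_⊎-↔_)
open import Data.Unit using (tt)
open import Data.Vec using (tabulate; lookup)
open import Data.Vec.Properties using (lookup∘tabulate; []=⇒lookup; lookup⇒[]=)
open import Function using (_∘_; id)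
open import Function.Bundles using (_↔_; _⇔_; Inverse; Injection; Equivalence; mk↔ₛ′; mk⇔)
open import Function.Definitions using (Injective)
open import Function.Properties.Inverse using (↔-sym; ↔-trans; ↔-refl; ↔⇒↣)
open import Function.Related.Propositional using (bijection; module EquationalReasoning)
open import Induction.WellFounded using (module All)
import Relation.Binary.Construct.NonStrictToStrict as ToStrict
open import Relation.Binary.PropositionalEquality using (_≢_; refl; sym; trans; cong; cong₂; subst; isEquivalence)
open import Relation.Binary.Structures using (IsPartialOrder)
open import Relation.Nullary using (¬_; yes; no; does)
open import Relation.Nullary.Decidable using (⌊_⌋; toWitness; fromWitness)
open import Relation.Nullary.Decidable.Core using (T?)

-- Counting the elements of Fin m satisfying a Boolean predicate

Sat : ∀ {m} → (Fin m → Bool) → Set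
Sat {m} p = Σ (Fin m) (T ∘ p)

Sat-≡ : ∀ {m} {p : Fin m → Bool} {s s′ : Sat p} → proj₁ s ≡ proj₁ s′ → s ≡ s′
Sat-≡ {s = z , t} {.z , t′} refl = cong (z ,_) (T-irrelevant t t′)

count : ∀ {m} → (Fin m → Bool) → ℕ
count {zero}  p = 0
count {suc m} p = if p zero then suc (count (p ∘ suc)) else count (p ∘ suc)

Sat-suc↔ : ∀ {m} (p : Fin (suc m) → Bool) → Sat p ↔ (T (p zero) ⊎ Sat (p ∘ suc))
Sat-suc↔ p = mk↔ₛ′ to from
  (λ { (inj₁ _) → refl ; (inj₂ _) → refl }) (λ { (zero , _) → refl ; (suc _ , _) → refl })
  where
  to : Sat p → T (p zero) ⊎ Sat (p ∘ suc)
  to (zero  , t) = inj₁ t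
  to (suc i , t) = inj₂ (i , t)

  from : T (p zero) ⊎ Sat (p ∘ suc) → Sat p
  from (inj₁ t)       = zero , t
  from (inj₂ (i , t)) = suc i , t

T⊎Fin↔ : ∀ b n → (T b ⊎ Fin n) ↔ Fin (if b then suc n else n)
T⊎Fin↔ true  n = mk↔ₛ′ [ (λ _ → zero) , suc ]′ (λ { zero → inj₁ tt ; (suc i) → inj₂ i })
  (λ { zero → refl ; (suc _) → refl }) (λ { (inj₁ _) → refl ; (inj₂ _) → refl })
T⊎Fin↔ false n = mk↔ₛ′ [ (λ ()) , id ]′ inj₂ (λ _ → refl) (λ { (inj₁ ()) ; (inj₂ _) → refl })

count↔ : ∀ {m} (p : Fin m → Bool) → Sat p ↔ Fin (count p)
count↔ {zero}  p = mk↔ₛ′ (λ { (() , _) }) (λ ()) (λ ()) (λ { (() , _) })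
count↔ {suc m} p = ↔-trans (Sat-suc↔ p) (↔-trans (↔-refl ⊎-↔ count↔ (p ∘ suc)) (T⊎Fin↔ (p zero) _))

Fin↔Fin⇒≡ : ∀ {a b} → Fin a ↔ Fin b → a ≡ b
Fin↔Fin⇒≡ e = cantor-schröder-bernstein (Injection.injective (↔⇒↣ e)) (Injection.injective (↔⇒↣ (↔-sym e)))

-- `does` rather than `⌊_⌋`, so that `(p ∖ suc a) ∘ suc` reduces to `(p ∘ suc) ∖ a` in `count-∖`.
_∖_ : ∀ {m} → (Fin m → Bool) → Fin m → Fin m → Bool
(p ∖ a) z = not (does (z ≟ a)) ∧ p z

count-∖ : ∀ {m} {p : Fin m → Bool} {a} → T (p a) → count p ≡ suc (count (p ∖ a))
count-∖ {suc m} {p} {zero} t with p zero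
... | true = refl
count-∖ {suc m} {p} {suc a} t with p zero | count-∖ {p = p ∘ suc} {a} t
... | true  | c = cong suc c
... | false | c = c

module _ {m : ℕ} where

  ∖-intro : ∀ {p : Fin m → Bool} {a z} → T (p z) → z ≢ a → T ((p ∖ a) z)
  ∖-intro {a = a} {z} t z≢a with z ≟ a
  ... | yes z≡a = z≢a z≡a
  ... | no _    = t

  ∖-elim : ∀ {p : Fin m → Bool} {a z} → T ((p ∖ a) z) → T (p z) × z ≢ a
  ∖-elim {a = a} {z} t with z ≟ a
  ... | no z≢a = t , z≢a

  witness : ∀ {p : Fin m → Bool} {k} → count p ≡ suc k → Sat p
  witness {p} c = Inverse.from (count↔ p) (subst Fin (sym c) zero)

  count≡0⇒∉ : ∀ {p : Fin m → Bool} {z} → count p ≡ 0 → ¬ T (p z)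
  count≡0⇒∉ {p} {z} c t with subst Fin c (Inverse.to (count↔ p) (z , t))
  ... | ()

  ∉⇒count≡0 : ∀ {p : Fin m → Bool} → (∀ z → ¬ T (p z)) → count p ≡ 0
  ∉⇒count≡0 {p} none = ℕ.n≤0⇒n≡0 (injective⇒≤ {f = ⊥-elim ∘ empty} (λ {i} → ⊥-elim (empty i)))
    where
    empty : Fin (count p) → ⊥
    empty i = none _ (proj₂ (Inverse.from (count↔ p) i))

  count-mono : ∀ {p q : Fin m → Bool} (f : Sat p → Sat q) → Injective _≡_ _≡_ f → count p ≤ count q
  count-mono {p} {q} f f-inj = injective⇒≤ {f = Inverse.to (count↔ q) ∘ f ∘ Inverse.from (count↔ p)}
    (Injection.injective (↔⇒↣ (↔-sym (count↔ p))) ∘ f-inj ∘ Injection.injective (↔⇒↣ (count↔ q)))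

  count-∖-pred : ∀ {p : Fin m → Bool} {a k} → count p ≡ suc k → T (p a) → count (p ∖ a) ≡ k
  count-∖-pred {p} c t = ℕ.suc-injective (trans (sym (count-∖ {p = p} t)) c)

  another : ∀ {p : Fin m → Bool} {a k} → count p ≡ suc (suc k) → T (p a) → ∃ λ c → T (p c) × c ≢ a
  another {p} c t with z , t′ ← witness {p = p ∖ _} (count-∖-pred {p = p} c t) = z , ∖-elim {p = p} t′

  another₂ : ∀ {p : Fin m → Bool} {a c k} → count p ≡ suc (suc (suc k)) → T (p a) → T (p c) → a ≢ c →
             ∃ λ d → T (p d) × d ≢ a × d ≢ c
  another₂ {p} {a} k ta tc a≢c
    with d , t , d≢c ← another {p = p ∖ a} (count-∖-pred {p = p} k ta) (∖-intro {p = p} tc (a≢c ∘ sym))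
    with pd , d≢a ← ∖-elim {p = p} t
    = d , pd , d≢a , d≢c

  count≡1⇒≡ : ∀ {p : Fin m → Bool} {a d} → count p ≡ 1 → T (p a) → T (p d) → d ≡ a
  count≡1⇒≡ {p} {a} {d} c ta td with d ≟ a
  ... | yes d≡a = d≡a
  ... | no  d≢a = ⊥-elim (count≡0⇒∉ {p = p ∖ a} (count-∖-pred {p = p} c ta) (∖-intro {p = p} td d≢a))

  count≡2⇒≡ : ∀ {p : Fin m → Bool} {a c d} → count p ≡ 2 → T (p a) → T (p c) → a ≢ c → T (p d) → d ≡ a ⊎ d ≡ c
  count≡2⇒≡ {p} {a} {c} {d} k ta tc a≢c td with d ≟ a
  ... | yes d≡a = inj₁ d≡a
  ... | no  d≢a = inj₂ (count≡1⇒≡ {p = p ∖ a} (count-∖-pred {p = p} k ta)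
                          (∖-intro {p = p} tc (a≢c ∘ sym)) (∖-intro {p = p} td d≢a))

  count≡3⇒≡ : ∀ {p : Fin m → Bool} {a c d e} → count p ≡ 3 → T (p a) → T (p c) → T (p d) →
              a ≢ c → a ≢ d → c ≢ d → T (p e) → e ≡ a ⊎ e ≡ c ⊎ e ≡ d
  count≡3⇒≡ {p} {a} {e = e} k ta tc td a≢c a≢d c≢d te with e ≟ a
  ... | yes e≡a = inj₁ e≡a
  ... | no  e≢a = inj₂ (count≡2⇒≡ {p = p ∖ a} (count-∖-pred {p = p} k ta)
                          (∖-intro {p = p} tc (a≢c ∘ sym)) (∖-intro {p = p} td (a≢d ∘ sym)) c≢d
                          (∖-intro {p = p} te e≢a))

-- Covers, atoms and maximal chains

T-not : ∀ {b} → T (not b) ⇔ (¬ T b)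
T-not {true}  = mk⇔ (λ ()) (λ f → f tt)
T-not {false} = mk⇔ (λ _ ()) (λ _ → tt)

T-any-allFin : ∀ {m} {f : Fin m → Bool} → T (any f (allFin m)) ⇔ ∃ λ w → T (f w)
T-any-allFin {m} {f} = mk⇔ (satisfied ∘ any⁻ f (allFin m)) (λ (w , t) → any⁺ f (lose (∈-allFin w) t))

_≼[_]_ : ∀ {m} → Fin m → FinPoset m → Fin m → Set
x ≼[ P ] y = T (FinPoset._≤ᵇ_ P x y)

module OrderTheory {m : ℕ} (P : FinPoset m) where
  open FinPoset P

  _≼_ : Fin m → Fin m → Set
  x ≼ y = x ≼[ P ] y

  _≺_ : Fin m → Fin m → Set
  _≺_ = ToStrict._<_ _≡_ _≼_

  _⋖_ : Fin m → Fin m → Set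
  x ⋖ y = T (_⋖ᵇ_ P x y)

  ≼-isPartialOrder : IsPartialOrder _≡_ _≼_
  ≼-isPartialOrder = record
    { isPreorder = record
      { isEquivalence = isEquivalence
      ; reflexive     = λ { {x} refl → ≤-refl x }
      ; trans         = ≤-trans _ _ _
      }
    ; antisym = ≤-antisym _ _
    }

  <ᵇ⇒≺ : ∀ {x y} → T (_<ᵇ_ P x y) → x ≺ y
  <ᵇ⇒≺ {x} {y} t with x ≤ᵇ y | x ≟ y
  ... | true  | no x≢y = tt , x≢y

  ≺⇒<ᵇ : ∀ {x y} → x ≺ y → T (_<ᵇ_ P x y)
  ≺⇒<ᵇ {x} {y} (x≼y , x≢y) = Equivalence.from T-∧ (x≼y , Equivalence.from T-not (x≢y ∘ toWitness))

  ⋖⇔ : ∀ {x y} → x ⋖ y ⇔ (x ≺ y × ¬ (∃ λ w → x ≺ w × w ≺ y))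
  ⋖⇔ {x} {y} = mk⇔
    (λ t → let x<y , ¬between = Equivalence.to T-∧ t in
      <ᵇ⇒≺ x<y , λ (w , x≺w , w≺y) →
        Equivalence.to T-not ¬between (Equivalence.from (T-any-allFin {f = between}) (w , between⇒ x≺w w≺y)))
    (λ (x≺y , none) → Equivalence.from T-∧ (≺⇒<ᵇ x≺y , Equivalence.from T-not λ t →
      let w , u = Equivalence.to (T-any-allFin {f = between}) t
          x<w , w<y = Equivalence.to T-∧ u
      in none (w , <ᵇ⇒≺ x<w , <ᵇ⇒≺ w<y)))
    where
    between : Fin m → Bool
    between w = (_<ᵇ_ P x w) ∧ (_<ᵇ_ P w y)

    between⇒ : ∀ {w} → x ≺ w → w ≺ y → T (between w)
    between⇒ x≺w w≺y = Equivalence.from T-∧ (≺⇒<ᵇ x≺w , ≺⇒<ᵇ w≺y)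

  ⋖⇒≺ : ∀ {x y} → x ⋖ y → x ≺ y
  ⋖⇒≺ = proj₁ ∘ Equivalence.to ⋖⇔

  ⋖⇒≼ : ∀ {x y} → x ⋖ y → x ≼ y
  ⋖⇒≼ = proj₁ ∘ ⋖⇒≺

  ⋖⇒≢ : ∀ {x y} → x ⋖ y → x ≢ y
  ⋖⇒≢ = proj₂ ∘ ⋖⇒≺

  ⋖⇒≢bottom : ∀ {b x a} → IsBottom P b → x ⋖ a → a ≢ b
  ⋖⇒≢bottom {x = x} isB x⋖a refl = ⋖⇒≢ x⋖a (≤-antisym _ _ (⋖⇒≼ x⋖a) (isB x))

  ≺-rec : (Q : Fin m → Set) → (∀ y → (∀ x → x ≺ y → Q x) → Q y) → ∀ y → Q y
  ≺-rec Q step = All.wfRec (po-wellFounded ≼-isPartialOrder) _ Q (λ y ih → step y (λ x → ih))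

  ≻-rec : (Q : Fin m → Set) → (∀ x → (∀ y → x ≺ y → Q y) → Q x) → ∀ x → Q x
  ≻-rec Q step = All.wfRec (po-noetherian ≼-isPartialOrder) _ Q (λ x ih → step x (λ y → ih))

  ∃-cover : ∀ {x y} → x ≺ y → ∃ λ a → x ⋖ a × a ≼ y
  ∃-cover {x} {y} = ≺-rec (λ y → x ≺ y → ∃ λ a → x ⋖ a × a ≼ y) step y
    where
    step : ∀ y → (∀ w → w ≺ y → x ≺ w → ∃ λ a → x ⋖ a × a ≼ w) → x ≺ y → ∃ λ a → x ⋖ a × a ≼ y
    step y ih x≺y with any? (λ w → T? (_<ᵇ_ P x w ∧ _<ᵇ_ P w y))
    ... | yes (w , t) =
      let x<w , w<y = Equivalence.to T-∧ t
          a , x⋖a , a≼w = ih w (<ᵇ⇒≺ w<y) (<ᵇ⇒≺ x<w)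
      in a , x⋖a , ≤-trans _ _ _ a≼w (proj₁ (<ᵇ⇒≺ w<y))
    ... | no none =
      y , Equivalence.from ⋖⇔ (x≺y , λ (w , x≺w , w≺y) → none (w , Equivalence.from T-∧ (≺⇒<ᵇ x≺w , ≺⇒<ᵇ w≺y)))
        , ≤-refl y

  atoms : Fin m → Fin m → Fin m → Bool
  atoms x y a = (_⋖ᵇ_ P x a) ∧ (a ≤ᵇ y)

  atom : ∀ {x y a} → x ⋖ a → a ≼ y → T (atoms x y a)
  atom x⋖a a≼y = Equivalence.from T-∧ (x⋖a , a≼y)

  atom⇒⋖ : ∀ {x y a} → T (atoms x y a) → x ⋖ a
  atom⇒⋖ = proj₁ ∘ Equivalence.to T-∧

  atom⇒≼ : ∀ {x y a} → T (atoms x y a) → a ≼ y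
  atom⇒≼ = proj₂ ∘ Equivalence.to T-∧

  MaxChains : Fin m → Fin m → Set
  MaxChains x y = Σ (List (Fin m)) (T ∘ isMaxChain P x y)

  maxChain⇒≼ : ∀ {x y} l → T (isMaxChain P x y l) → x ≼ y
  maxChain⇒≼ []      t with refl ← toWitness t = ≤-refl _
  maxChain⇒≼ (z ∷ l) t =
    let x⋖z , rest = Equivalence.to T-∧ t in ≤-trans _ _ _ (⋖⇒≼ x⋖z) (maxChain⇒≼ l rest)

  MaxChains↔first-atom : ∀ {x y} → x ≢ y → MaxChains x y ↔ Σ (Sat (atoms x y)) (λ a → MaxChains (proj₁ a) y)
  MaxChains↔first-atom {x} {y} x≢y = mk↔ₛ′ to from
    (λ { ((z , a) , l , t) → cong₂ (λ a t → (z , a) , l , t) (T-irrelevant _ _) (T-irrelevant _ _) })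
    (λ { ([] , t) → ⊥-elim (x≢y (toWitness t)) ; (z ∷ l , t) → cong (z ∷ l ,_) (T-irrelevant _ _) })
    where
    to : MaxChains x y → Σ (Sat (atoms x y)) (λ a → MaxChains (proj₁ a) y)
    to ([]    , t) = ⊥-elim (x≢y (toWitness t))
    to (z ∷ l , t) = let x⋖z , rest = Equivalence.to T-∧ t in (z , atom x⋖z (maxChain⇒≼ l rest)) , l , rest
    from : Σ (Sat (atoms x y)) (λ a → MaxChains (proj₁ a) y) → MaxChains x y
    from ((z , a) , l , t) = z ∷ l , Equivalence.from T-∧ (atom⇒⋖ a , t)

  count-maxChains : ∀ {x y N M} → x ≢ y → NumMaxChains P x y N →
                    (∀ {a} → x ⋖ a → a ≼ y → NumMaxChains P a y M) → N ≡ count (atoms x y) * M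
  count-maxChains {x} {y} {N} {M} x≢y chains≅N chains≅M = Fin↔Fin⇒≡ (begin
    Fin N                                             ↔⟨ ↔-sym chains≅N ⟩
    MaxChains x y                                     ↔⟨ MaxChains↔first-atom x≢y ⟩
    Σ (Sat (atoms x y)) (λ a → MaxChains (proj₁ a) y) ↔⟨ congˡ {k = bijection} (λ {s} → chains≅M (atom⇒⋖ {x} {y} (proj₂ s))
                                                                                       (atom⇒≼ {x} (proj₂ s))) ⟩
    (Sat (atoms x y) × Fin M)                         ↔⟨ count↔ (atoms x y) ×-↔ ↔-refl ⟩
    (Fin (count (atoms x y)) × Fin M)                 ↔⟨ ↔-sym *↔× ⟩
    Fin (count (atoms x y) * M)                       ∎)
    where open EquationalReasoning {k = bijection}

-- Graded posets

module Graded {m : ℕ} (P : FinPoset m) (ρ : Fin m → ℕ) (ρ-⋖ : ∀ x y → T (_⋖ᵇ_ P x y) → ρ y ≡ suc (ρ x)) where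
  open OrderTheory P

  ρ-mono : ∀ {x y} → x ≼ y → ρ x ≤ ρ y
  ρ-mono {x} {y} = ≻-rec (λ x → x ≼ y → ρ x ≤ ρ y) step x
    where
    step : ∀ x → (∀ a → x ≺ a → a ≼ y → ρ a ≤ ρ y) → x ≼ y → ρ x ≤ ρ y
    step x ih x≼y with x ≟ y
    ... | yes refl = ℕ.≤-refl
    ... | no x≢y =
      let a , x⋖a , a≼y = ∃-cover (x≼y , x≢y)
      in ℕ.<⇒≤ (subst (_≤ ρ y) (ρ-⋖ x a x⋖a) (ih a (⋖⇒≺ x⋖a) a≼y))

  ρ-< : ∀ {x y} → x ≺ y → ρ x < ρ y
  ρ-< {x} {y} x≺y = let a , x⋖a , a≼y = ∃-cover x≺y in subst (_≤ ρ y) (ρ-⋖ x a x⋖a) (ρ-mono a≼y)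

  ρ-injective : ∀ {x y} → x ≼ y → ρ x ≡ ρ y → x ≡ y
  ρ-injective {x} {y} x≼y ρx≡ρy with x ≟ y
  ... | yes x≡y = x≡y
  ... | no  x≢y = ⊥-elim (ℕ.<-irrefl ρx≡ρy (ρ-< (x≼y , x≢y)))

  ρ⇒⋖ : ∀ {x y} → x ≼ y → ρ y ≡ suc (ρ x) → x ⋖ y
  ρ⇒⋖ {x} {y} x≼y ρy≡1+ρx = Equivalence.from ⋖⇔ ((x≼y , x≢y) , λ (w , x≺w , w≺y) →
    ℕ.<-irrefl refl (ℕ.≤-trans (s≤s (ρ-< x≺w)) (subst (ρ w <_) ρy≡1+ρx (ρ-< w≺y))))
    where
    x≢y : x ≢ y
    x≢y refl = ℕ.1+n≢n (sym ρy≡1+ρx)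

  ⋖-sibling : ∀ {x a b c} → x ⋖ a → a ⋖ b → x ⋖ c → c ≼ b → c ⋖ b
  ⋖-sibling {x} {a} {b} {c} x⋖a a⋖b x⋖c c≼b =
    ρ⇒⋖ c≼b (trans (ρ-⋖ a b a⋖b) (cong suc (trans (ρ-⋖ x a x⋖a) (sym (ρ-⋖ x c x⋖c)))))

-- Upper intervals are Boolean when every interval has rank-many atoms

∈⇔T-lookup : ∀ {k} {S : Subset k} {i} → i ∈ S ⇔ T (lookup S i)
∈⇔T-lookup {S = S} {i} = mk⇔ (Equivalence.from T-≡ ∘ []=⇒lookup) (lookup⇒[]= i S ∘ Equivalence.to T-≡)

∈-tabulate : ∀ {k} {f : Fin k → Bool} {i} → i ∈ tabulate f ⇔ T (f i)
∈-tabulate {f = f} {i} = mk⇔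
  (λ i∈ → subst T (lookup∘tabulate f i) (Equivalence.to ∈⇔T-lookup i∈))
  (λ t → Equivalence.from ∈⇔T-lookup (subst T (sym (lookup∘tabulate f i)) t))

module UpperIntervals {m : ℕ} (P : FinPoset m) (bot top : Fin m) (isB : IsBottom P bot) (isT : IsTop P top)
  (ρ : Fin m → ℕ) (ρ-⋖ : ∀ x y → T (_⋖ᵇ_ P x y) → ρ y ≡ suc (ρ x))
  (atoms-count : ∀ {x y} j → x ≢ bot → x ≼[ P ] y → ρ y ≡ j + ρ x → count (OrderTheory.atoms P x y) ≡ j)
  where
  open FinPoset P
  open OrderTheory P
  open Graded P ρ ρ-⋖

  ⋖⇒≢bot : ∀ {x a} → x ⋖ a → a ≢ bot
  ⋖⇒≢bot = ⋖⇒≢bottom isB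

  atoms-rank : ∀ {x y} → x ≢ bot → x ≼ y → ρ y ≡ count (atoms x y) + ρ x
  atoms-rank {x} {y} x≢⊥ x≼y = trans (sym ρy) (cong (_+ ρ x) (sym (atoms-count (ρ y ∸ ρ x) x≢⊥ x≼y (sym ρy))))
    where
    ρy : ρ y ∸ ρ x + ρ x ≡ ρ y
    ρy = ℕ.m∸n+n≡m (ρ-mono x≼y)

  ρ-⋖⋖ : ∀ {x a b} → x ⋖ a → a ⋖ b → ρ b ≡ 2 + ρ x
  ρ-⋖⋖ x⋖a a⋖b = trans (ρ-⋖ _ _ a⋖b) (cong suc (ρ-⋖ _ _ x⋖a))

  partner : ∀ {x a b} → x ≢ bot → x ⋖ a → a ⋖ b → ∃ λ c → x ⋖ c × c ≼ b × c ≢ a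
  partner {x} {a} {b} x≢⊥ x⋖a a⋖b
    with c , t , c≢a ← another {p = atoms x b} (atoms-count _ x≢⊥ (≤-trans _ _ _ (⋖⇒≼ x⋖a) (⋖⇒≼ a⋖b)) (ρ-⋖⋖ x⋖a a⋖b))
                         (atom x⋖a (⋖⇒≼ a⋖b))
    = c , atom⇒⋖ t , atom⇒≼ {x} t , c≢a

  length-two-atoms : ∀ {x y a c d} → x ≢ bot → x ≼ y → ρ y ≡ 2 + ρ x →
                     T (atoms x y a) → T (atoms x y c) → a ≢ c → T (atoms x y d) → d ≡ a ⊎ d ≡ c
  length-two-atoms {x} {y} x≢⊥ x≼y ρy = count≡2⇒≡ {p = atoms x y} (atoms-count _ x≢⊥ x≼y ρy)

  CommonCoverUnique : Fin m → Set
  CommonCoverUnique x = ∀ {a c b b′} → x ⋖ a → x ⋖ c → a ≢ c → a ⋖ b → c ⋖ b → a ⋖ b′ → c ⋖ b′ → b ≡ b′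

  JoinsBelow : Fin m → Set
  JoinsBelow x = ∀ {a c w} → x ⋖ a → x ⋖ c → a ≢ c → a ≼ w → c ≼ w → ∃ λ b → a ⋖ b × c ⋖ b × b ≼ w

  two-common-covers-⊥ : ∀ {x a c b b′ v} → x ≢ bot → x ⋖ a → x ⋖ c → a ≢ c →
                        a ⋖ b → c ⋖ b → a ⋖ b′ → c ⋖ b′ → b ≢ b′ → b ⋖ v → b′ ⋖ v → ⊥
  -- [x, v] has three atoms a, c, d. A cover p of d below v also covers a second atom of x, which is
  -- a or c; as b, b′ are the two covers of that atom below v, p ∈ {b, b′}. Then the length-two
  -- interval [x, p] has the three atoms a, c, d.
  two-common-covers-⊥ {x} {a} {c} {b} {b′} {v} x≢⊥ x⋖a x⋖c a≢c a⋖b c⋖b a⋖b′ c⋖b′ b≢b′ b⋖v b′⋖v =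
    from-third-atom (another₂ {p = atoms x v} three-atoms (atom x⋖a (≼v a⋖b)) (atom x⋖c (≼v c⋖b)) a≢c)
    where
    ≼v : ∀ {e} → e ⋖ b → e ≼ v
    ≼v e⋖b = ≤-trans _ _ _ (⋖⇒≼ e⋖b) (⋖⇒≼ b⋖v)

    ρv≡3+ρx : ρ v ≡ 3 + ρ x
    ρv≡3+ρx = trans (ρ-⋖⋖ a⋖b b⋖v) (cong (2 +_) (ρ-⋖ x a x⋖a))

    three-atoms : count (atoms x v) ≡ 3
    three-atoms = atoms-count _ x≢⊥ (≤-trans _ _ _ (⋖⇒≼ x⋖a) (≼v a⋖b)) ρv≡3+ρx

    from-third-atom : (∃ λ d → T (atoms x v d) × d ≢ a × d ≢ c) → ⊥
    from-third-atom (d , d-atom , d≢a , d≢c)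
      with p , p-atom ← witness {p = atoms d v} (atoms-count _ (⋖⇒≢bot (atom⇒⋖ d-atom)) (atom⇒≼ {x} d-atom)
                                                   (trans ρv≡3+ρx (cong (2 +_) (sym (ρ-⋖ x d (atom⇒⋖ d-atom))))))
      with o , x⋖o , o≼p , o≢d ← partner x≢⊥ (atom⇒⋖ d-atom) (atom⇒⋖ {d} {v} p-atom)
      = [ d≢a , d≢c ]′ (length-two-atoms x≢⊥ (≤-trans _ _ _ (⋖⇒≼ x⋖d) (⋖⇒≼ d⋖p)) (ρ-⋖⋖ x⋖d d⋖p)
                          (atom x⋖a (above-p a⋖b a⋖b′)) (atom x⋖c (above-p c⋖b c⋖b′)) a≢c (atom x⋖d (⋖⇒≼ d⋖p)))
      where
      x⋖d : x ⋖ d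
      x⋖d = atom⇒⋖ d-atom

      d⋖p : d ⋖ p
      d⋖p = atom⇒⋖ {d} {v} p-atom

      p≼v : p ≼ v
      p≼v = atom⇒≼ {d} {v} p-atom

      p-covers : ∀ {e} → x ⋖ e → e ⋖ b → e ⋖ b′ → o ≡ e → p ≡ b ⊎ p ≡ b′
      p-covers {e} x⋖e e⋖b e⋖b′ refl = length-two-atoms (⋖⇒≢bot x⋖e) (≼v e⋖b) (ρ-⋖⋖ e⋖b b⋖v)
        (atom e⋖b (⋖⇒≼ b⋖v)) (atom e⋖b′ (⋖⇒≼ b′⋖v)) b≢b′ (atom (⋖-sibling x⋖d d⋖p x⋖e o≼p) p≼v)

      p≡b⊎p≡b′ : p ≡ b ⊎ p ≡ b′
      p≡b⊎p≡b′ =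
        [ p-covers x⋖a a⋖b a⋖b′ , [ p-covers x⋖c c⋖b c⋖b′ , ⊥-elim ∘ o≢d ]′ ]′
          (count≡3⇒≡ {p = atoms x v} three-atoms (atom x⋖a (≼v a⋖b)) (atom x⋖c (≼v c⋖b)) d-atom
            a≢c (d≢a ∘ sym) (d≢c ∘ sym) (atom x⋖o (≤-trans _ _ _ o≼p p≼v)))

      above-p : ∀ {e} → e ⋖ b → e ⋖ b′ → e ≼ p
      above-p e⋖b e⋖b′ with p≡b⊎p≡b′
      ... | inj₁ refl = ⋖⇒≼ e⋖b
      ... | inj₂ refl = ⋖⇒≼ e⋖b′

  common-cover-unique-step : ∀ {x} → x ≢ bot → (∀ {a} → x ⋖ a → JoinsBelow a) → CommonCoverUnique x
  common-cover-unique-step x≢⊥ joins {b = b} {b′} x⋖a x⋖c a≢c a⋖b c⋖b a⋖b′ c⋖b′ with b ≟ b′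
  ... | yes b≡b′ = b≡b′
  ... | no  b≢b′ with v , b⋖v , b′⋖v , _ ← joins x⋖a a⋖b a⋖b′ b≢b′ (isT b) (isT b′)
    = ⊥-elim (two-common-covers-⊥ x≢⊥ x⋖a x⋖c a≢c a⋖b c⋖b a⋖b′ c⋖b′ b≢b′ b⋖v b′⋖v)

  joins-below-step : ∀ {x} → x ≢ bot → CommonCoverUnique x → JoinsBelow x
  joins-below-step {x} x≢⊥ unique {a} {c} {w} x⋖a x⋖c a≢c a≼w c≼w
    with any? (λ b → T? (atoms a w b ∧ (c ≤ᵇ b)))
  ... | yes (b , t) with b-atom , c≼b ← Equivalence.to T-∧ t =
    b , atom⇒⋖ b-atom , ⋖-sibling x⋖a (atom⇒⋖ b-atom) x⋖c c≼b , atom⇒≼ {a} b-atom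
  -- Otherwise b ↦ (the atom of [x, b] other than a) injects the atoms of [a, w] into the atoms of
  -- [x, w] other than a and c, of which there is one fewer.
  ... | no none =
    ⊥-elim (ℕ.<-irrefl refl (ℕ.≤-trans (ℕ.≤-reflexive (sym counts)) (count-mono partnerOf partnerOf-injective)))
    where
    others : Fin m → Bool
    others = (atoms x w ∖ a) ∖ c

    Partner : Fin m → Set
    Partner b = ∃ λ o → x ⋖ o × o ≼ b × o ≢ a

    partner-in-others : ∀ {b} → T (atoms a w b) → Partner b → Sat others
    partner-in-others {b} t (o , x⋖o , o≼b , o≢a) =
      o , ∖-intro {p = atoms x w ∖ a} (∖-intro {p = atoms x w} (atom x⋖o (≤-trans _ _ _ o≼b (atom⇒≼ {a} t))) o≢a) o≢c
      where
      o≢c : o ≢ c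
      o≢c refl = none (b , Equivalence.from T-∧ (t , o≼b))

    partnerOf : Sat (atoms a w) → Sat others
    partnerOf (b , t) = partner-in-others t (partner x≢⊥ x⋖a (atom⇒⋖ t))

    same-partner⇒≡ : ∀ {b b′} → T (atoms a w b) → T (atoms a w b′) → (π : Partner b) (π′ : Partner b′) →
                     proj₁ π ≡ proj₁ π′ → b ≡ b′
    same-partner⇒≡ t t′ (o , x⋖o , o≼b , o≢a) (.o , _ , o≼b′ , _) refl =
      unique x⋖a x⋖o (o≢a ∘ sym) (atom⇒⋖ t) (⋖-sibling x⋖a (atom⇒⋖ t) x⋖o o≼b)
                                  (atom⇒⋖ t′) (⋖-sibling x⋖a (atom⇒⋖ t′) x⋖o o≼b′)

    partnerOf-injective : ∀ {s s′} → partnerOf s ≡ partnerOf s′ → s ≡ s′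
    partnerOf-injective {b , t} {b′ , t′} eq =
      Sat-≡ (same-partner⇒≡ t t′ (partner x≢⊥ x⋖a (atom⇒⋖ t)) (partner x≢⊥ x⋖a (atom⇒⋖ t′)) (cong proj₁ eq))

    counts : count (atoms a w) ≡ suc (count others)
    counts = ℕ.suc-injective (trans (sym (atoms-count _ x≢⊥ (≤-trans _ _ _ (⋖⇒≼ x⋖a) a≼w) ρw))
               (trans (count-∖ {p = atoms x w} (atom x⋖a a≼w))
                      (cong suc (count-∖ {p = atoms x w ∖ a} (∖-intro {p = atoms x w} (atom x⋖c c≼w) (a≢c ∘ sym))))))
      where
      ρw : ρ w ≡ suc (count (atoms a w)) + ρ x
      ρw = trans (atoms-rank (⋖⇒≢bot x⋖a) a≼w) (trans (cong (count (atoms a w) +_) (ρ-⋖ x a x⋖a)) (ℕ.+-suc _ _))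

  common-covers : ∀ x → x ≢ bot → CommonCoverUnique x × JoinsBelow x
  common-covers = ≻-rec (λ x → x ≢ bot → CommonCoverUnique x × JoinsBelow x) λ x ih x≢⊥ →
    let unique = common-cover-unique-step x≢⊥ (λ x⋖a → proj₂ (ih _ (⋖⇒≺ x⋖a) (⋖⇒≢bot x⋖a)))
    in unique , joins-below-step x≢⊥ unique

  common-cover-unique : ∀ {x} → x ≢ bot → CommonCoverUnique x
  common-cover-unique = proj₁ ∘ common-covers _

  joins-below : ∀ {x} → x ≢ bot → JoinsBelow x
  joins-below = proj₂ ∘ common-covers _

  atoms-determine-≼ : ∀ {x z w} → x ≢ bot → x ≼ z → x ≼ w → (∀ {c} → x ⋖ c → c ≼ z → c ≼ w) → z ≼ w
  atoms-determine-≼ {x} {z} {w} = ≻-rec Q step x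
    where
    Q : Fin m → Set
    Q x = x ≢ bot → x ≼ z → x ≼ w → (∀ {c} → x ⋖ c → c ≼ z → c ≼ w) → z ≼ w

    step : ∀ x → (∀ a → x ≺ a → Q a) → Q x
    step x ih x≢⊥ x≼z x≼w below with x ≟ z
    ... | yes refl = x≼w
    ... | no x≢z with a , x⋖a , a≼z ← ∃-cover (x≼z , x≢z) =
      ih a (⋖⇒≺ x⋖a) (⋖⇒≢bot x⋖a) a≼z (below x⋖a a≼z) (covers-below x⋖a a≼z)
      where
      covers-below : ∀ {a b} → x ⋖ a → a ≼ z → a ⋖ b → b ≼ z → b ≼ w
      covers-below x⋖a a≼z a⋖b b≼z
        with o , x⋖o , o≼b , o≢a ← partner x≢⊥ x⋖a a⋖b
        with b′ , a⋖b′ , o⋖b′ , b′≼w ← joins-below x≢⊥ x⋖a x⋖o (o≢a ∘ sym)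
                                         (below x⋖a a≼z) (below x⋖o (≤-trans _ _ _ o≼b b≼z))
        = subst (_≼ w) (common-cover-unique x≢⊥ x⋖a x⋖o (o≢a ∘ sym) a⋖b′ o⋖b′ a⋖b (⋖-sibling x⋖a a⋖b x⋖o o≼b)) b′≼w

  AtomSetsRealised : Fin m → Set
  AtomSetsRealised x = (S : Fin m → Bool) → (∀ {c} → T (S c) → x ⋖ c) →
                       ∃ λ v → x ≼ v × (∀ {c} → x ⋖ c → T (S c) ⇔ c ≼ v)

  -- For an atom a of x: the covers b of a such that the other atom of [x, b] lies in S.
  above-others : Fin m → (Fin m → Bool) → Fin m → Bool
  above-others a S b = (_⋖ᵇ_ P a b) ∧ any (λ c → (S ∖ a) c ∧ (c ≤ᵇ b)) (allFin m)

  atom-sets-realised-step : ∀ {x} → x ≢ bot → (∀ {a} → x ⋖ a → AtomSetsRealised a) → AtomSetsRealised x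
  atom-sets-realised-step {x} x≢⊥ ih S S⊆atoms with any? (λ c → T? (S c))
  ... | no none = x , ≤-refl x , λ x⋖c →
    mk⇔ (λ sc → ⊥-elim (none (_ , sc))) (λ c≼x → ⊥-elim (⋖⇒≢ x⋖c (≤-antisym _ _ (⋖⇒≼ x⋖c) c≼x)))
  ... | yes (a , sa) = extend (ih (S⊆atoms sa) (above-others a S) (proj₁ ∘ Equivalence.to T-∧))
    where
    x⋖a : x ⋖ a
    x⋖a = S⊆atoms sa

    above-others-intro : ∀ {b c} → a ⋖ b → T (S c) → c ≢ a → c ≼ b → T (above-others a S b)
    above-others-intro {b} a⋖b sc c≢a c≼b = Equivalence.from T-∧ (a⋖b ,
      Equivalence.from (T-any-allFin {f = λ c → (S ∖ a) c ∧ (c ≤ᵇ b)})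
        (_ , Equivalence.from T-∧ (∖-intro {p = S} sc c≢a , c≼b)))

    above-others-elim : ∀ {b} → T (above-others a S b) → ∃ λ c → T (S c) × c ≢ a × c ≼ b
    above-others-elim {b} t
      with c , u ← Equivalence.to (T-any-allFin {f = λ c → (S ∖ a) c ∧ (c ≤ᵇ b)}) (proj₂ (Equivalence.to T-∧ t))
      with sc∖a , c≼b ← Equivalence.to T-∧ u
      with sc , c≢a ← ∖-elim {p = S} sc∖a
      = c , sc , c≢a , c≼b

    extend : (∃ λ v → a ≼ v × (∀ {b} → a ⋖ b → T (above-others a S b) ⇔ b ≼ v)) →
             ∃ λ v → x ≼ v × (∀ {c} → x ⋖ c → T (S c) ⇔ c ≼ v)
    extend (v , a≼v , spec) = v , ≤-trans _ _ _ (⋖⇒≼ x⋖a) a≼v , realised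
      where
      realised : ∀ {c} → x ⋖ c → T (S c) ⇔ c ≼ v
      realised {c} x⋖c with c ≟ a
      ... | yes refl = mk⇔ (λ _ → a≼v) (λ _ → sa)
      ... | no  c≢a = mk⇔ to from
        where
        to : T (S c) → c ≼ v
        to sc with b , a⋖b , c⋖b , _ ← joins-below x≢⊥ x⋖a x⋖c (c≢a ∘ sym) (isT a) (isT c) =
          ≤-trans _ _ _ (⋖⇒≼ c⋖b) (Equivalence.to (spec a⋖b) (above-others-intro a⋖b sc c≢a (⋖⇒≼ c⋖b)))

        from : c ≼ v → T (S c)
        from c≼v with b , a⋖b , c⋖b , b≼v ← joins-below x≢⊥ x⋖a x⋖c (c≢a ∘ sym) a≼v c≼v
                 with c′ , sc′ , c′≢a , c′≼b ← above-others-elim (Equivalence.from (spec a⋖b) b≼v)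
          = [ ⊥-elim ∘ c′≢a , (λ c′≡c → subst (T ∘ S) c′≡c sc′) ]′
              (length-two-atoms x≢⊥ (≤-trans _ _ _ (⋖⇒≼ x⋖a) (⋖⇒≼ a⋖b)) (ρ-⋖⋖ x⋖a a⋖b)
                 (atom x⋖a (⋖⇒≼ a⋖b)) (atom x⋖c (⋖⇒≼ c⋖b)) (c≢a ∘ sym) (atom (S⊆atoms sc′) c′≼b))

  atom-sets-realised : ∀ {x} → x ≢ bot → AtomSetsRealised x
  atom-sets-realised {x} = ≻-rec (λ x → x ≢ bot → AtomSetsRealised x)
    (λ x ih x≢⊥ → atom-sets-realised-step x≢⊥ (λ x⋖a → ih _ (⋖⇒≺ x⋖a) (⋖⇒≢bot x⋖a))) x

  module BooleanUpperInterval {x : Fin m} {j : ℕ} (x≢⊥ : x ≢ bot) (count≡j : count (atoms x top) ≡ j) where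
    enum : Sat (atoms x top) ↔ Fin j
    enum = subst (λ n → Sat (atoms x top) ↔ Fin n) count≡j (count↔ (atoms x top))

    atomAt : Fin j → Fin m
    atomAt i = proj₁ (Inverse.from enum i)

    x⋖atomAt : ∀ i → x ⋖ atomAt i
    x⋖atomAt i = atom⇒⋖ (proj₂ (Inverse.from enum i))

    indexOf : ∀ {c} → x ⋖ c → Fin j
    indexOf {c} x⋖c = Inverse.to enum (c , atom x⋖c (isT c))

    atomAt-indexOf : ∀ {c} (x⋖c : x ⋖ c) → atomAt (indexOf x⋖c) ≡ c
    atomAt-indexOf {c} x⋖c = cong proj₁ (Inverse.strictlyInverseʳ enum (c , atom x⋖c (isT c)))

    atomAt-injective : ∀ {i i′} → atomAt i ≡ atomAt i′ → i ≡ i′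
    atomAt-injective {i} {i′} eq = trans (sym (Inverse.strictlyInverseˡ enum i))
      (trans (cong (Inverse.to enum) (Sat-≡ eq)) (Inverse.strictlyInverseˡ enum i′))

    atomSet : Fin m → Subset j
    atomSet z = tabulate (λ i → atomAt i ≤ᵇ z)

    ∈atomSet : ∀ {i z} → i ∈ atomSet z ⇔ atomAt i ≼ z
    ∈atomSet = ∈-tabulate

    atomSet-≼ : ∀ {z w} → x ≼ z → x ≼ w → z ≼ w ⇔ atomSet z ⊆ atomSet w
    atomSet-≼ {z} {w} x≼z x≼w = mk⇔
      (λ z≼w {_} i∈ → Equivalence.from ∈atomSet (≤-trans _ _ _ (Equivalence.to ∈atomSet i∈) z≼w))
      (λ (z⊆w : atomSet z ⊆ atomSet w) → atoms-determine-≼ x≢⊥ x≼z x≼w λ {c} x⋖c c≼z →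
        subst (_≼ w) (atomAt-indexOf x⋖c)
          (Equivalence.to ∈atomSet
            (z⊆w {indexOf x⋖c} (Equivalence.from ∈atomSet (subst (_≼ z) (sym (atomAt-indexOf x⋖c)) c≼z)))))

    indexed : Subset j → Fin m → Bool
    indexed S c = any (λ i → lookup S i ∧ ⌊ atomAt i ≟ c ⌋) (allFin j)

    indexed⇔ : ∀ {S c} → T (indexed S c) ⇔ ∃ λ i → i ∈ S × atomAt i ≡ c
    indexed⇔ {S} {c} = mk⇔
      (λ t → let i , u = Equivalence.to (T-any-allFin {f = λ i → lookup S i ∧ ⌊ atomAt i ≟ c ⌋}) t
                 i∈S , eq = Equivalence.to T-∧ u
             in i , Equivalence.from ∈⇔T-lookup i∈S , toWitness eq)
      (λ (i , i∈S , eq) → Equivalence.from (T-any-allFin {f = λ i → lookup S i ∧ ⌊ atomAt i ≟ c ⌋})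
        (i , Equivalence.from T-∧ (Equivalence.to ∈⇔T-lookup i∈S , fromWitness eq)))

    indexed-atoms : ∀ {S c} → T (indexed S c) → x ⋖ c
    indexed-atoms {S} t = let i , _ , eq = Equivalence.to (indexed⇔ {S}) t in subst (x ⋖_) eq (x⋖atomAt i)

    atomSet-onto : ∀ S → ∃ λ z → x ≼ z × atomSet z ≡ S
    atomSet-onto S with v , x≼v , spec ← atom-sets-realised x≢⊥ (indexed S) (indexed-atoms {S})
      = v , x≼v , ⊆-antisym
          (λ {i} i∈ → let i′ , i′∈S , eq = Equivalence.to (indexed⇔ {S})
                                             (Equivalence.from (spec (x⋖atomAt i)) (Equivalence.to ∈atomSet i∈))
                      in subst (_∈ S) (atomAt-injective eq) i′∈S)
          (λ {i} i∈S → Equivalence.from ∈atomSet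
                          (Equivalence.to (spec (x⋖atomAt i)) (Equivalence.from (indexed⇔ {S}) (i , i∈S , refl))))

-- Recognising a dual suspension of a Boolean algebra

module DualSuspensionRecognition {m k : ℕ} (P : FinPoset m) (bot a₁ a₂ : Fin m) (isB : IsBottom P bot)
  (a₁≢bot : a₁ ≢ bot) (a₂≢bot : a₂ ≢ bot) (a₁⋠a₂ : ¬ a₁ ≼[ P ] a₂) (a₂⋠a₁ : ¬ a₂ ≼[ P ] a₁)
  (above-atoms : ∀ {z} → z ≢ bot → z ≢ a₁ → z ≢ a₂ → a₁ ≼[ P ] z × a₂ ≼[ P ] z)
  (φ : Fin m → Subset k)
  (φ-≼ : ∀ {z w} → a₁ ≼[ P ] z → a₁ ≼[ P ] w → z ≼[ P ] w ⇔ φ z ⊆ φ w)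
  (φ-onto : ∀ S → ∃ λ z → a₁ ≼[ P ] z × φ z ≡ S)
  where
  open FinPoset P
  open OrderTheory P

  ≢⇒⋠ : ∀ {z w} → z ≢ w → w ≼ z → ¬ z ≼ w
  ≢⇒⋠ z≢w w≼z z≼w = z≢w (≤-antisym _ _ z≼w w≼z)

  φa₁≡⊥ : φ a₁ ≡ Subset.⊥
  φa₁≡⊥ with z , a₁≼z , φz≡⊥ ← φ-onto Subset.⊥ =
    ⊆-antisym (subst (φ a₁ ⊆_) φz≡⊥ (Equivalence.to (φ-≼ (≤-refl a₁) a₁≼z) a₁≼z)) ⊥⊆

  module UpperElement {z : Fin m} (z≢bot : z ≢ bot) (z≢a₁ : z ≢ a₁) (z≢a₂ : z ≢ a₂) where
    a₁≼z : a₁ ≼ z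
    a₁≼z = proj₁ (above-atoms z≢bot z≢a₁ z≢a₂)

    a₂≼z : a₂ ≼ z
    a₂≼z = proj₂ (above-atoms z≢bot z≢a₁ z≢a₂)

    φ-nonempty : Nonempty (φ z)
    φ-nonempty with nonempty? (φ z)
    ... | yes nonempty = nonempty
    ... | no  empty    = ⊥-elim (≢⇒⋠ z≢a₁ a₁≼z (Equivalence.from (φ-≼ a₁≼z (≤-refl a₁))
                           (subst (φ z ⊆_) (trans (Empty-unique empty) (sym φa₁≡⊥)) (λ i∈ → i∈))))

    φ≢⊥ : φ z ≢ Subset.⊥
    φ≢⊥ φz≡⊥ = ∉⊥ (subst (proj₁ φ-nonempty ∈_) φz≡⊥ (proj₂ φ-nonempty))

    ⋠bot : ¬ z ≼ bot
    ⋠bot = ≢⇒⋠ z≢bot (isB z)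

    ⋠a₁ : ¬ z ≼ a₁
    ⋠a₁ = ≢⇒⋠ z≢a₁ a₁≼z

    ⋠a₂ : ¬ z ≼ a₂
    ⋠a₂ z≼a₂ = a₁⋠a₂ (≤-trans _ _ _ a₁≼z z≼a₂)

  data View (z : Fin m) : Set where
    at-bot : z ≡ bot → View z
    at-a₁  : z ≡ a₁ → View z
    at-a₂  : z ≡ a₂ → View z
    upper  : z ≢ bot → z ≢ a₁ → z ≢ a₂ → View z

  view : ∀ z → View z
  view z with z ≟ bot | z ≟ a₁ | z ≟ a₂
  ... | yes z≡bot | _        | _        = at-bot z≡bot
  ... | no _      | yes z≡a₁ | _        = at-a₁ z≡a₁
  ... | no _      | no _     | yes z≡a₂ = at-a₂ z≡a₂
  ... | no z≢bot  | no z≢a₁  | no z≢a₂  = upper z≢bot z≢a₁ z≢a₂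

  fromView : ∀ {z} → View z → DualSuspBool k
  fromView (at-bot _)          = inj₁ Subset.⊥
  fromView (at-a₁ _)           = inj₂ false
  fromView (at-a₂ _)           = inj₂ true
  fromView {z} (upper _ _ _)   = inj₁ (φ z)

  to : Fin m → DualSuspBool k
  to z = fromView (view z)

  to-bot : to bot ≡ inj₁ Subset.⊥
  to-bot with view bot
  ... | at-bot _      = refl
  ... | at-a₁ bot≡a₁  = ⊥-elim (a₁≢bot (sym bot≡a₁))
  ... | at-a₂ bot≡a₂  = ⊥-elim (a₂≢bot (sym bot≡a₂))
  ... | upper bot≢bot _ _ = ⊥-elim (bot≢bot refl)

  to-a₁ : to a₁ ≡ inj₂ false
  to-a₁ with view a₁
  ... | at-bot a₁≡bot = ⊥-elim (a₁≢bot a₁≡bot)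
  ... | at-a₁ _       = refl
  ... | at-a₂ a₁≡a₂   = ⊥-elim (a₁⋠a₂ (subst (a₁ ≼_) a₁≡a₂ (≤-refl a₁)))
  ... | upper _ a₁≢a₁ _ = ⊥-elim (a₁≢a₁ refl)

  to-a₂ : to a₂ ≡ inj₂ true
  to-a₂ with view a₂
  ... | at-bot a₂≡bot = ⊥-elim (a₂≢bot a₂≡bot)
  ... | at-a₁ a₂≡a₁   = ⊥-elim (a₂⋠a₁ (subst (a₂ ≼_) a₂≡a₁ (≤-refl a₂)))
  ... | at-a₂ _       = refl
  ... | upper _ _ a₂≢a₂ = ⊥-elim (a₂≢a₂ refl)

  to-upper : ∀ {z} → z ≢ bot → z ≢ a₁ → z ≢ a₂ → to z ≡ inj₁ (φ z)
  to-upper {z} z≢bot z≢a₁ z≢a₂ with view z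
  ... | at-bot z≡bot = ⊥-elim (z≢bot z≡bot)
  ... | at-a₁ z≡a₁   = ⊥-elim (z≢a₁ z≡a₁)
  ... | at-a₂ z≡a₂   = ⊥-elim (z≢a₂ z≡a₂)
  ... | upper _ _ _  = refl

  realiser : Subset k → Fin m
  realiser S = proj₁ (φ-onto S)

  module Realiser {S : Subset k} (nonempty : Nonempty S) where
    a₁≼r : a₁ ≼ realiser S
    a₁≼r = proj₁ (proj₂ (φ-onto S))

    φr≡S : φ (realiser S) ≡ S
    φr≡S = proj₂ (proj₂ (φ-onto S))

    r≢bot : realiser S ≢ bot
    r≢bot r≡bot = a₁≢bot (≤-antisym _ _ (subst (a₁ ≼_) r≡bot a₁≼r) (isB a₁))

    r≢a₁ : realiser S ≢ a₁
    r≢a₁ r≡a₁ = let i , i∈S = nonempty in ∉⊥ (subst (i ∈_) (trans (sym φr≡S) (trans (cong φ r≡a₁) φa₁≡⊥)) i∈S)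

    r≢a₂ : realiser S ≢ a₂
    r≢a₂ r≡a₂ = a₁⋠a₂ (subst (a₁ ≼_) r≡a₂ a₁≼r)

    to-realiser : to (realiser S) ≡ inj₁ S
    to-realiser = trans (to-upper r≢bot r≢a₁ r≢a₂) (cong inj₁ φr≡S)

  from : DualSuspBool k → Fin m
  from (inj₁ S) with nonempty? S
  ... | yes _ = realiser S
  ... | no  _ = bot
  from (inj₂ false) = a₁
  from (inj₂ true)  = a₂

  to∘from : ∀ s → to (from s) ≡ s
  to∘from (inj₁ S) with nonempty? S
  ... | yes nonempty = Realiser.to-realiser nonempty
  ... | no  empty    = trans to-bot (cong inj₁ (sym (Empty-unique empty)))
  to∘from (inj₂ false) = to-a₁
  to∘from (inj₂ true)  = to-a₂

  from∘to : ∀ z → from (to z) ≡ z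
  from∘to z with view z
  ... | at-bot refl with nonempty? (Subset.⊥ {k})
  ...   | yes (_ , i∈⊥) = ⊥-elim (∉⊥ i∈⊥)
  ...   | no  _         = refl
  from∘to z | at-a₁ refl = refl
  from∘to z | at-a₂ refl = refl
  from∘to z | upper z≢bot z≢a₁ z≢a₂ with nonempty? (φ z)
  ...   | no  empty    = ⊥-elim (empty (UpperElement.φ-nonempty z≢bot z≢a₁ z≢a₂))
  ...   | yes nonempty =
    let r≼z = Equivalence.from (φ-≼ a₁≼r a₁≼z) (subst (_⊆ φ z) (sym φr≡S) (λ i∈ → i∈))
        z≼r = Equivalence.from (φ-≼ a₁≼z a₁≼r) (subst (φ z ⊆_) (sym φr≡S) (λ i∈ → i∈))
    in ≤-antisym _ _ r≼z z≼r
    where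
    open Realiser nonempty
    a₁≼z = UpperElement.a₁≼z z≢bot z≢a₁ z≢a₂

  ≼⇔≤Σ : ∀ x y → x ≼ y ⇔ (to x ≤Σ to y)
  ≼⇔≤Σ x y with view x | view y
  ... | at-bot refl | at-bot refl = mk⇔ (λ _ {_} → ⊥⊆) (λ _ → isB bot)
  ... | at-bot refl | at-a₁ refl  = mk⇔ (λ _ → refl) (λ _ → isB a₁)
  ... | at-bot refl | at-a₂ refl  = mk⇔ (λ _ → refl) (λ _ → isB a₂)
  ... | at-bot refl | upper _ _ _ = mk⇔ (λ _ {_} → ⊥⊆) (λ _ → isB y)
  ... | at-a₁ refl  | at-bot refl = mk⇔ (⊥-elim ∘ ≢⇒⋠ a₁≢bot (isB a₁)) (λ (_ , i∈⊥) → ⊥-elim (∉⊥ i∈⊥))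
  ... | at-a₁ refl  | at-a₁ refl  = mk⇔ (λ _ → refl) (λ _ → ≤-refl a₁)
  ... | at-a₁ refl  | at-a₂ refl  = mk⇔ (⊥-elim ∘ a₁⋠a₂) (λ ())
  ... | at-a₁ refl  | upper y≢bot y≢a₁ y≢a₂ = mk⇔ (λ _ → φ-nonempty) (λ _ → a₁≼z)
    where open UpperElement y≢bot y≢a₁ y≢a₂
  ... | at-a₂ refl  | at-bot refl = mk⇔ (⊥-elim ∘ ≢⇒⋠ a₂≢bot (isB a₂)) (λ (_ , i∈⊥) → ⊥-elim (∉⊥ i∈⊥))
  ... | at-a₂ refl  | at-a₁ refl  = mk⇔ (⊥-elim ∘ a₂⋠a₁) (λ ())
  ... | at-a₂ refl  | at-a₂ refl  = mk⇔ (λ _ → refl) (λ _ → ≤-refl a₂)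
  ... | at-a₂ refl  | upper y≢bot y≢a₁ y≢a₂ = mk⇔ (λ _ → φ-nonempty) (λ _ → a₂≼z)
    where open UpperElement y≢bot y≢a₁ y≢a₂
  ... | upper x≢bot x≢a₁ x≢a₂ | at-bot refl =
    mk⇔ (⊥-elim ∘ ⋠bot) (λ φx⊆⊥ → let i , i∈ = φ-nonempty in ⊥-elim (∉⊥ (φx⊆⊥ i∈)))
    where open UpperElement x≢bot x≢a₁ x≢a₂
  ... | upper x≢bot x≢a₁ x≢a₂ | at-a₁ refl = mk⇔ (⊥-elim ∘ ⋠a₁) (⊥-elim ∘ φ≢⊥)
    where open UpperElement x≢bot x≢a₁ x≢a₂
  ... | upper x≢bot x≢a₁ x≢a₂ | at-a₂ refl = mk⇔ (⊥-elim ∘ ⋠a₂) (⊥-elim ∘ φ≢⊥)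
    where open UpperElement x≢bot x≢a₁ x≢a₂
  ... | upper x≢bot x≢a₁ x≢a₂ | upper y≢bot y≢a₁ y≢a₂ =
    φ-≼ (UpperElement.a₁≼z x≢bot x≢a₁ x≢a₂) (UpperElement.a₁≼z y≢bot y≢a₁ y≢a₂)

  isoToDualSuspBool : IsoToDualSuspBool P k
  isoToDualSuspBool = mk↔ₛ′ to from to∘from from∘to , ≼⇔≤Σ

-- Sheffer posets with factorial functions

module FactorialSheffer {m : ℕ} (P : FinPoset m) (bot top : Fin m) (ρ : Fin m → ℕ) (k : ℕ) (B D : ℕ → ℕ)
  (isB : IsBottom P bot) (isT : IsTop P top) (rank : IsRankFunction P bot ρ) (ρ-top : ρ top ≡ 2 + k)
  (sheffer : IsSheffer P bot ρ B D)
  (B-factorial : ∀ j → j ≤ suc k → B j ≡ j !)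
  (D-factorial : ∀ j → 2 ≤ j → j ≤ 2 + k → D j ≡ 2 * (j ∸ 1) !)
  where
  open FinPoset P
  open OrderTheory P
  open Graded P ρ (proj₂ rank)

  ρ≤ρ-top : ∀ y → ρ y ≤ 2 + k
  ρ≤ρ-top y = subst (ρ y ≤_) ρ-top (ρ-mono (isT y))

  1≤ρ : ∀ {x} → x ≢ bot → 1 ≤ ρ x
  1≤ρ {x} x≢⊥ = subst (_< ρ x) (proj₁ rank) (ρ-< (isB x , x≢⊥ ∘ sym))

  chains-above : ∀ {x y j} → x ≢ bot → x ≼ y → ρ y ≡ j + ρ x → NumMaxChains P x y (j !)
  chains-above {x} {y} {j} x≢⊥ x≼y ρy = subst (NumMaxChains P x y) B≡j! (proj₂ sheffer x y x≢⊥ x≼y)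
    where
    j≤1+k : j ≤ suc k
    j≤1+k = ℕ.≤-pred (ℕ.≤-trans (subst (_≤ j + ρ x) (ℕ.+-comm j 1) (ℕ.+-monoʳ-≤ j (1≤ρ x≢⊥)))
                                (subst (_≤ 2 + k) ρy (ρ≤ρ-top y)))
    B≡j! : B (ρ y ∸ ρ x) ≡ j !
    B≡j! = trans (cong B (trans (cong (_∸ ρ x) ρy) (ℕ.m+n∸n≡m j (ρ x)))) (B-factorial j j≤1+k)

  atoms-count : ∀ {x y} j → x ≢ bot → x ≼ y → ρ y ≡ j + ρ x → count (atoms x y) ≡ j
  atoms-count {x} {y} zero x≢⊥ x≼y ρy with refl ← ρ-injective x≼y (sym ρy) =
    ∉⇒count≡0 {p = atoms x x} λ a t → ⋖⇒≢ (atom⇒⋖ t) (≤-antisym _ _ (⋖⇒≼ (atom⇒⋖ t)) (atom⇒≼ {x} t))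
  atoms-count {x} {y} (suc j) x≢⊥ x≼y ρy =
    ℕ.*-cancelʳ-≡ (count (atoms x y)) (suc j) (j !) {{ℕ._!≢0 j}}
      (sym (count-maxChains x≢y (chains-above x≢⊥ x≼y ρy) chains-from-atom))
    where
    x≢y : x ≢ y
    x≢y refl = ℕ.m≢1+n+m (ρ x) ρy
    chains-from-atom : ∀ {a} → x ⋖ a → a ≼ y → NumMaxChains P a y (j !)
    chains-from-atom {a} x⋖a a≼y =
      chains-above (⋖⇒≢bottom isB x⋖a) a≼y
        (trans ρy (sym (trans (cong (j +_) (proj₂ rank x a x⋖a)) (ℕ.+-suc j (ρ x)))))

  ρ-atom : ∀ {a} → bot ⋖ a → ρ a ≡ 1
  ρ-atom {a} bot⋖a = trans (proj₂ rank bot a bot⋖a) (cong suc (proj₁ rank))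

  bottom-atoms : ∀ {y j} → ρ y ≡ 2 + j → count (atoms bot y) ≡ 2
  bottom-atoms {y} {j} ρy =
    ℕ.*-cancelʳ-≡ (count (atoms bot y)) 2 (suc j !) {{ℕ._!≢0 (suc j)}}
      (sym (trans (sym D≡) (count-maxChains bot≢y (proj₁ sheffer y (bot≢y ∘ sym)) chains-from-atom)))
    where
    bot≢y : bot ≢ y
    bot≢y refl = ℕ.0≢1+n (trans (sym (proj₁ rank)) ρy)
    D≡ : D (ρ y) ≡ 2 * suc j !
    D≡ = trans (cong D ρy) (D-factorial (2 + j) (s≤s (s≤s z≤n)) (subst (_≤ 2 + k) ρy (ρ≤ρ-top y)))
    chains-from-atom : ∀ {a} → bot ⋖ a → a ≼ y → NumMaxChains P a y (suc j !)
    chains-from-atom {a} bot⋖a a≼y = chains-above (⋖⇒≢bottom isB bot⋖a) a≼y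
      (trans ρy (trans (ℕ.+-comm 2 j) (trans (ℕ.+-suc j 1) (cong (suc j +_) (sym (ρ-atom bot⋖a))))))

  open UpperIntervals P bot top isB isT ρ (proj₂ rank) atoms-count

  P-atoms : count (atoms bot top) ≡ 2
  P-atoms = bottom-atoms ρ-top

  atom-below : ∀ {a y j} → bot ⋖ a → ρ y ≡ 2 + j → a ≼ y
  atom-below {a} {y} bot⋖a ρy = from-first (witness {p = atoms bot y} (bottom-atoms ρy))
    where
    from-both : ∀ {u} → T (atoms bot y u) → (∃ λ u′ → T (atoms bot y u′) × u′ ≢ u) → a ≼ y
    from-both {u} u-atom (u′ , u′-atom , u′≢u) =
      [ (λ a≡u → subst (_≼ y) (sym a≡u) (atom⇒≼ {bot} {y} u-atom))
      , (λ a≡u′ → subst (_≼ y) (sym a≡u′) (atom⇒≼ {bot} {y} u′-atom)) ]′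
        (count≡2⇒≡ {p = atoms bot top} P-atoms
           (atom (atom⇒⋖ {bot} {y} u-atom) (isT u)) (atom (atom⇒⋖ {bot} {y} u′-atom) (isT u′))
           (u′≢u ∘ sym) (atom bot⋖a (isT a)))

    from-first : Sat (atoms bot y) → a ≼ y
    from-first (u , u-atom) = from-both u-atom (another {p = atoms bot y} (bottom-atoms ρy) u-atom)

  module TwoAtoms {a₁ a₂ : Fin m} (bot⋖a₁ : bot ⋖ a₁) (bot⋖a₂ : bot ⋖ a₂) (a₁≢a₂ : a₁ ≢ a₂) where
    a₁⋠a₂ : ¬ a₁ ≼ a₂
    a₁⋠a₂ a₁≼a₂ = a₁≢a₂ (ρ-injective a₁≼a₂ (trans (ρ-atom bot⋖a₁) (sym (ρ-atom bot⋖a₂))))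

    a₂⋠a₁ : ¬ a₂ ≼ a₁
    a₂⋠a₁ a₂≼a₁ = a₁≢a₂ (sym (ρ-injective a₂≼a₁ (trans (ρ-atom bot⋖a₂) (sym (ρ-atom bot⋖a₁)))))

    rank≥2 : ∀ {z} → z ≢ bot → z ≢ a₁ → z ≢ a₂ → ∃ λ j → ρ z ≡ 2 + j
    rank≥2 {z} z≢⊥ z≢a₁ z≢a₂ = from-rank (ρ z) refl
      where
      from-rank : ∀ r → ρ z ≡ r → ∃ λ j → ρ z ≡ 2 + j
      from-rank zero          ρz = ⊥-elim (z≢⊥ (sym (ρ-injective (isB z) (trans (proj₁ rank) (sym ρz)))))
      from-rank (suc zero)    ρz = ⊥-elim ([ z≢a₁ , z≢a₂ ]′ (count≡2⇒≡ {p = atoms bot top} P-atoms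
        (atom bot⋖a₁ (isT a₁)) (atom bot⋖a₂ (isT a₂)) a₁≢a₂
        (atom (ρ⇒⋖ (isB z) (trans ρz (cong suc (sym (proj₁ rank))))) (isT z))))
      from-rank (suc (suc j)) ρz = j , ρz

    above-atoms : ∀ {z} → z ≢ bot → z ≢ a₁ → z ≢ a₂ → a₁ ≼ z × a₂ ≼ z
    above-atoms z≢⊥ z≢a₁ z≢a₂ = let j , ρz = rank≥2 z≢⊥ z≢a₁ z≢a₂ in atom-below bot⋖a₁ ρz , atom-below bot⋖a₂ ρz

    a₁-atoms : count (atoms a₁ top) ≡ suc k
    a₁-atoms = atoms-count (suc k) (⋖⇒≢bot bot⋖a₁) (isT a₁)
      (trans ρ-top (trans (cong suc (ℕ.+-comm 1 k)) (cong (suc k +_) (sym (ρ-atom bot⋖a₁)))))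

    open BooleanUpperInterval (⋖⇒≢bot bot⋖a₁) a₁-atoms

    isoToDualSuspBool : IsoToDualSuspBool P (suc k)
    isoToDualSuspBool = DualSuspensionRecognition.isoToDualSuspBool P bot a₁ a₂ isB
      (⋖⇒≢bot bot⋖a₁) (⋖⇒≢bot bot⋖a₂) a₁⋠a₂ a₂⋠a₁ above-atoms atomSet atomSet-≼ atomSet-onto

  isoToDualSuspBool : IsoToDualSuspBool P (suc k)
  isoToDualSuspBool = from-first-atom (witness {p = atoms bot top} P-atoms)
    where
    from-first-atom : Sat (atoms bot top) → IsoToDualSuspBool P (suc k)
    from-first-atom (a₁ , t₁) = from-second-atom (another {p = atoms bot top} P-atoms t₁)
      where
      from-second-atom : (∃ λ a₂ → T (atoms bot top a₂) × a₂ ≢ a₁) → IsoToDualSuspBool P (suc k)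
      from-second-atom (a₂ , t₂ , a₂≢a₁) =
        TwoAtoms.isoToDualSuspBool (atom⇒⋖ {bot} {top} t₁) (atom⇒⋖ {bot} {top} t₂) (a₂≢a₁ ∘ sym)

lemma4p11 : ∀ {m} (P : FinPoset m) (n : ℕ) (ρ : Fin m → ℕ) (bot top : Fin m) (B D : ℕ → ℕ) →
    2 ≤ n →
    IsBottom P bot → IsTop P top →
    IsRankFunction P bot ρ → ρ top ≡ n →
    IsSheffer P bot ρ B D →
    (∀ k → k ≤ n ∸ 1 → B k ≡ k !) →
    (∀ k → 2 ≤ k → k ≤ n → D k ≡ 2 * (k ∸ 1) !) →
    IsEulerian P ρ →
    IsoToDualSuspBool P (n ∸ 1)
lemma4p11 _ zero _ _ _ _ _ ()
lemma4p11 _ (suc zero) _ _ _ _ _ (s≤s ())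
lemma4p11 P (suc (suc k)) ρ bot top B D _ isB isT rank ρ-top sheffer B-factorial D-factorial _ =
  FactorialSheffer.isoToDualSuspBool P bot top ρ k B D isB isT rank ρ-top sheffer B-factorial D-factorial
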